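{- For positive integers $m,n$, the sparing number of the square of the complete bipartite graph $K_{m,n}$ is $\varphi(K_{m,n}^2)=\frac{1}{2}(m+n-1)(m+n-2)$.
   Context: All graphs are simple and finite. $\mathbb{N}_0$ denotes the set of non-negative integers. For non-empty $A,B\subseteq\mathbb{N}_0$, $A+B=\{a+b: a\in A, b\in B\}$. An integer additive set-indexer (IASI) of a graph $G$ is an injective function $f:V(G)\to\mathcal{P}(\mathbb{N}_0)$ with non-empty values such that the induced map $f^+(uv)=f(u)+f(v)$ on $E(G)$ is also injective. An IASI is weak if $|f^+(uv)|=\max(|f(u)|,|f(v)|)$ for every edge $uv$. An element (vertex or edge) is mono-indexed if its set-label has cardinality $1$. The sparing number $\varphi(H)$ of a graph $H$ is the minimum number of mono-indexed edges over all weak IASIs of $H$. The square $G^2$ of $G$ has vertex set $V(G)$, two distinct vertices adjacent iff their distance in $G$ is at most $2$. -}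

module Defs where

open import Data.Nat using (ℕ; _+_; _≤_; _⊔_; _≡ᵇ_; _<ᵇ_)
open import Data.Nat.Properties using (_≟_)
open import Data.Bool using (Bool; true; false; _∧_; _∨_; not; _xor_)
open import Data.Fin using (Fin; toℕ)
open import Data.List using (List; []; map; concatMap; length; deduplicate; filterᵇ; cartesianProduct; allFin)
open import Data.Bool.ListAction using (any)
open import Data.List.Membership.Propositional using (_∈_)
open import Data.Product using (_×_; _,_; Σ; Σ-syntax)
open import Relation.Binary.PropositionalEquality using (_≡_; _≢_)
open import Function.Bundles using (_⇔_)

-- A finite subset of ℕ₀ is represented by a list of its elements
-- (duplicates and order irrelevant).
FinSet : Set
FinSet = List ℕ

_≐_ : FinSet → FinSet → Set
A ≐ B = ∀ x → (x ∈ A) ⇔ (x ∈ B)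

card : FinSet → ℕ
card A = length (deduplicate _≟_ A)

_⊕_ : FinSet → FinSet → FinSet
A ⊕ B = concatMap (λ a → map (a +_) B) A

Graph : ℕ → Set
Graph N = Fin N → Fin N → Bool

_==_ : ∀ {N} → Fin N → Fin N → Bool
u == v = toℕ u ≡ᵇ toℕ v

-- Complete bipartite graph K_{m,n}: vertices 0..m-1 form one part, m..m+n-1 the other.
K : (m n : ℕ) → Graph (m + n)
K m n u v = (toℕ u <ᵇ m) xor (toℕ v <ᵇ m)

square : ∀ {N} → Graph N → Graph N
square {N} G u v = not (u == v) ∧ (G u v ∨ any (λ w → G u w ∧ G w v) (allFin N))

-- Edges are represented as pairs (u , v) with u < v and u adjacent to v.
isEdge : ∀ {N} → Graph N → Fin N → Fin N → Bool
isEdge G u v = (toℕ u <ᵇ toℕ v) ∧ G u v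

IsEdge : ∀ {N} → Graph N → Fin N → Fin N → Set
IsEdge G u v = isEdge G u v ≡ true

record IASI {N : ℕ} (G : Graph N) (f : Fin N → FinSet) : Set where
  field
    nonempty   : ∀ v → f v ≢ []
    injective  : ∀ u v → f u ≐ f v → u ≡ v
    edgeInj    : ∀ u v u′ v′ → IsEdge G u v → IsEdge G u′ v′ →
                 (f u ⊕ f v) ≐ (f u′ ⊕ f v′) → (u ≡ u′ × v ≡ v′)

record WeakIASI {N : ℕ} (G : Graph N) (f : Fin N → FinSet) : Set where
  field
    iasi : IASI G f
    weak : ∀ u v → IsEdge G u v → card (f u ⊕ f v) ≡ card (f u) ⊔ card (f v)

monoCount : ∀ {N} → Graph N → (Fin N → FinSet) → ℕ
monoCount {N} G f =
  length (filterᵇ (λ { (u , v) → isEdge G u v ∧ (card (f u ⊕ f v) ≡ᵇ 1) })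
                  (cartesianProduct (allFin N) (allFin N)))

SparingNumber : ∀ {N} → Graph N → ℕ → Set
SparingNumber {N} G k =
  (Σ[ f ∈ (Fin N → FinSet) ] (WeakIASI G f × monoCount G f ≡ k)) ×
  (∀ (f : Fin N → FinSet) → WeakIASI G f → k ≤ monoCount G f)

-- For m, n ≥ 1 every two vertices of K_{m,n} are at distance at most 2,
-- so K_{m,n}² is the complete graph on N = m + n vertices, and the theorem
-- is really about weak IASIs of complete graphs:
--
--  * Sumsets: if |B| ≥ 2 then |A + B| > |A|.  Hence the labels of the two
--    ends of an edge of a weak IASI cannot both have two or more elements,
--    and an edge is mono-indexed exactly when both of its ends are.
--  * Counting: in a complete graph the mono-indexed edges are therefore the
--    pairs of mono-indexed vertices, and at most one vertex is not
--    mono-indexed; so a weak IASI has C(k,2) mono-indexed edges with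
--    k ≥ N - 1 mono-indexed vertices.
--  * Construction: the labelling {0,1}, {1}, {2}, {4}, ..., {2^(N-2)} is a
--    weak IASI of every graph (distinct pairs of powers of two have distinct
--    sums) with exactly N - 1 mono-indexed vertices.
module Submission where

open import Defs
open import Data.Nat using (ℕ; zero; suc; _+_; _*_; _∸_; _^_; _≤_; _<_; _/_; _⊔_; z≤n; s≤s; _≡ᵇ_; _<ᵇ_)
open import Data.Nat.Properties
open import Data.Nat.DivMod using (m*n/n≡m)
open import Data.Bool using (Bool; true; false; _∧_; _∨_; not; _xor_; T?)
open import Data.Bool.Properties using (∨-zeroʳ; xor-inverseʳ; xor-inverseˡ; T-≡)
import Data.Bool.Properties as Bool
open import Data.Fin using (Fin; zero; suc; toℕ; fromℕ<)
open import Data.Fin.Properties using (toℕ-fromℕ<; toℕ-injective)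
open import Data.List using (List; []; _∷_; map; length; deduplicate; filter; filterᵇ; tabulate; cartesianProduct; _++_)
open import Data.List.Properties using (filter-notAll; length-map; length-++; filter-++; map-tabulate)
open import Data.Bool.ListAction using (any)
open import Data.List.Membership.Propositional using (_∈_)
open import Data.List.Membership.Propositional.Properties
  using (∈-++⁺ˡ; ∈-++⁺ʳ; ∈-++⁻; ∈-map⁺; ∈-map⁻; ∈-filter⁺; ∈-deduplicate⁺; ∈-deduplicate⁻; ∈-allFin)
open import Data.List.Relation.Binary.Subset.Propositional using (_⊆_)
open import Data.List.Relation.Unary.Any as Any using (here; there)
open import Data.List.Relation.Unary.All as All using (All; _∷_)
open import Data.List.Relation.Unary.AllPairs using (_∷_)
open import Data.List.Relation.Unary.Unique.Propositional using (Unique)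
import Data.List.Relation.Unary.Unique.DecPropositional.Properties as UniqueDec
import Data.List.Relation.Unary.Unique.Propositional.Properties as Unique
open import Data.Product using (_×_; _,_; ∃; ∃₂)
open import Data.Sum using (_⊎_; inj₁; inj₂)
open import Data.Empty using (⊥; ⊥-elim)
open import Relation.Nullary using (¬?; yes; no)
open import Relation.Nullary.Decidable using (dec-false)
open import Relation.Binary.Definitions using (DecidableEquality; tri<; tri≈; tri>)
open import Relation.Binary.PropositionalEquality
open import Function using (_∘_; id)
open import Function.Bundles using (Equivalence)
open Equivalence using (to; from)

unique⊆⇒length≤ : ∀ {A : Set} (_≟ᴬ_ : DecidableEquality A) {xs ys : List A} →
                  Unique xs → xs ⊆ ys → length xs ≤ length ys
unique⊆⇒length≤ _≟ᴬ_ {[]} _ _ = z≤n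
unique⊆⇒length≤ _≟ᴬ_ {x ∷ xs} {ys} (x∉xs ∷ unique) xs⊆ys =
  ≤-trans (s≤s (unique⊆⇒length≤ _≟ᴬ_ unique xs⊆others))
          (filter-notAll (¬? ∘ (x ≟ᴬ_)) ys (Any.map (λ x≡y x≢y → x≢y x≡y) (xs⊆ys (here refl))))
  where
  -- the tail avoids x, so it lies in ys with the copies of x removed
  xs⊆others : xs ⊆ filter (¬? ∘ (x ≟ᴬ_)) ys
  xs⊆others z∈xs = ∈-filter⁺ (¬? ∘ (x ≟ᴬ_)) (xs⊆ys (there z∈xs)) (All.lookup x∉xs z∈xs)

card-mono : ∀ {A B} → A ⊆ B → card A ≤ card B
card-mono {A} {B} A⊆B =
  unique⊆⇒length≤ _≟_ (UniqueDec.deduplicate-! _≟_ A)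
    (∈-deduplicate⁺ _≟_ ∘ A⊆B ∘ ∈-deduplicate⁻ _≟_ A)

card-pos : ∀ A → A ≢ [] → 1 ≤ card A
card-pos []      A≢[] = ⊥-elim (A≢[] refl)
card-pos (a ∷ A) _    = s≤s z≤n

∈-⊕⁺ : ∀ A B {a b} → a ∈ A → b ∈ B → a + b ∈ A ⊕ B
∈-⊕⁺ (a ∷ A) B (here refl) b∈B = ∈-++⁺ˡ (∈-map⁺ (a +_) b∈B)
∈-⊕⁺ (a ∷ A) B (there a∈A) b∈B = ∈-++⁺ʳ (map (a +_) B) (∈-⊕⁺ A B a∈A b∈B)

∈-⊕⁻ : ∀ A B {x} → x ∈ A ⊕ B → ∃₂ λ a b → a ∈ A × b ∈ B × x ≡ a + b
∈-⊕⁻ (a ∷ A) B x∈ with ∈-++⁻ (map (a +_) B) x∈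
... | inj₁ x∈a+B with ∈-map⁻ (a +_) x∈a+B
...   | b , b∈B , x≡a+b = a , b , here refl , b∈B , x≡a+b
∈-⊕⁻ (a ∷ A) B x∈ | inj₂ x∈A⊕B with ∈-⊕⁻ A B x∈A⊕B
... | a′ , b , a′∈A , b∈B , x≡a′+b = a′ , b , there a′∈A , b∈B , x≡a′+b

⊕-comm : ∀ A B → A ⊕ B ⊆ B ⊕ A
⊕-comm A B x∈ with ∈-⊕⁻ A B x∈
... | a , b , a∈A , b∈B , refl = subst (_∈ B ⊕ A) (+-comm b a) (∈-⊕⁺ B A b∈B a∈A)

maximum : ∀ a A → ∃ λ m → m ∈ a ∷ A × (∀ {x} → x ∈ a ∷ A → x ≤ m)
maximum a [] = a , here refl , λ { (here refl) → ≤-refl }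
maximum a (b ∷ A) with maximum b A
... | m , m∈ , ≤m with ≤-total a m
...   | inj₁ a≤m = m , there m∈ , λ { (here refl) → a≤m ; (there x∈) → ≤m x∈ }
...   | inj₂ m≤a = a , here refl , λ { (here refl) → ≤-refl ; (there x∈) → ≤-trans (≤m x∈) m≤a }

two-elements : ∀ B → 2 ≤ card B → ∃₂ λ b b′ → b ∈ B × b′ ∈ B × b < b′
two-elements B 2≤ = from-list (deduplicate _≟_ B) 2≤ (UniqueDec.deduplicate-! _≟_ B) (∈-deduplicate⁻ _≟_ B)
  where
  from-list : ∀ D → 2 ≤ length D → Unique D → D ⊆ B → ∃₂ λ b b′ → b ∈ B × b′ ∈ B × b < b′
  from-list []          ()            _ _
  from-list (_ ∷ [])    (s≤s ())      _ _
  from-list (x ∷ y ∷ D) _ ((x≢y ∷ _) ∷ _) D⊆B with <-cmp x y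
  ... | tri< x<y _ _ = x , y , D⊆B (here refl) , D⊆B (there (here refl)) , x<y
  ... | tri≈ _ x≡y _ = ⊥-elim (x≢y x≡y)
  ... | tri> _ _ y<x = y , x , D⊆B (there (here refl)) , D⊆B (here refl) , y<x

-- Adding a set with two elements b < b′ strictly enlarges a non-empty set:
-- the sums x + b (x ∈ A) are distinct and all smaller than (max A) + b′.
card-⊕-grows : ∀ A B → A ≢ [] → 2 ≤ card B → suc (card A) ≤ card (A ⊕ B)
card-⊕-grows []        B A≢[] _  = ⊥-elim (A≢[] refl)
card-⊕-grows (a ∷ A′) B _    2≤B with maximum a A′ | two-elements B 2≤B
... | m , m∈A , ≤m | b , b′ , b∈B , b′∈B , b<b′ =
  subst (_≤ card (A ⊕ B)) (cong suc (length-map (_+ b) D))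
        (unique⊆⇒length≤ _≟_ sums-unique sums⊆A⊕B)
  where
  A = a ∷ A′
  D = deduplicate _≟_ A
  sums = (m + b′) ∷ map (_+ b) D

  top-is-new : All (m + b′ ≢_) (map (_+ b) D)
  top-is-new = All.tabulate λ y∈ → case (∈-map⁻ (_+ b) y∈)
    where
    case : ∀ {y} → ∃ (λ x → x ∈ D × y ≡ x + b) → m + b′ ≢ y
    case (x , x∈D , refl) eq = <-irrefl (sym eq) (+-mono-≤-< (≤m (∈-deduplicate⁻ _≟_ A x∈D)) b<b′)

  sums-unique : Unique sums
  sums-unique = top-is-new ∷ Unique.map⁺ (+-cancelʳ-≡ b _ _) (UniqueDec.deduplicate-! _≟_ A)

  sums⊆A⊕B : sums ⊆ deduplicate _≟_ (A ⊕ B)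
  sums⊆A⊕B (here refl) = ∈-deduplicate⁺ _≟_ (∈-⊕⁺ A B m∈A b′∈B)
  sums⊆A⊕B (there y∈) with ∈-map⁻ (_+ b) y∈
  ... | x , x∈D , refl = ∈-deduplicate⁺ _≟_ (∈-⊕⁺ A B (∈-deduplicate⁻ _≟_ A x∈D) b∈B)

large-summands-not-weak : ∀ A B → A ≢ [] → B ≢ [] → 2 ≤ card A → 2 ≤ card B →
                          card (A ⊕ B) ≢ card A ⊔ card B
large-summands-not-weak A B A≢[] B≢[] 2≤A 2≤B weak with ≤-total (card A) (card B)
... | inj₁ A≤B = <-irrefl refl (begin-strict
  card B                <⟨ card-⊕-grows B A B≢[] 2≤A ⟩
  card (B ⊕ A)          ≤⟨ card-mono (⊕-comm B A) ⟩
  card (A ⊕ B)          ≡⟨ trans weak (m≤n⇒m⊔n≡n A≤B) ⟩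
  card B                ∎)
  where open ≤-Reasoning
... | inj₂ B≤A = <-irrefl refl (begin-strict
  card A                <⟨ card-⊕-grows A B A≢[] 2≤B ⟩
  card (A ⊕ B)          ≡⟨ trans weak (m≥n⇒m⊔n≡m B≤A) ⟩
  card A                ∎)
  where open ≤-Reasoning

isMono : FinSet → Bool
isMono A = card A ≡ᵇ 1

mono-or-large : ∀ c → 1 ≤ c → (c ≡ᵇ 1) ≡ true ⊎ 2 ≤ c
mono-or-large 1             _ = inj₁ refl
mono-or-large (suc (suc c)) _ = inj₂ (s≤s (s≤s z≤n))

weak-sum-has-mono-summand : ∀ A B → A ≢ [] → B ≢ [] → card (A ⊕ B) ≡ card A ⊔ card B →
                            isMono A ≡ true ⊎ isMono B ≡ true
weak-sum-has-mono-summand A B A≢[] B≢[] weak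
  with mono-or-large (card A) (card-pos A A≢[]) | mono-or-large (card B) (card-pos B B≢[])
... | inj₁ monoA | _          = inj₁ monoA
... | inj₂ _     | inj₁ monoB = inj₂ monoB
... | inj₂ 2≤A   | inj₂ 2≤B   = ⊥-elim (large-summands-not-weak A B A≢[] B≢[] 2≤A 2≤B weak)

⊔-is-one : ∀ a b → 1 ≤ a → 1 ≤ b → (a ⊔ b ≡ᵇ 1) ≡ (a ≡ᵇ 1) ∧ (b ≡ᵇ 1)
⊔-is-one 1             1             _ _ = refl
⊔-is-one 1             (suc (suc b)) _ _ = refl
⊔-is-one (suc (suc a)) 1             _ _ = refl
⊔-is-one (suc (suc a)) (suc (suc b)) _ _ = refl

weak-sum-mono : ∀ A B → A ≢ [] → B ≢ [] → card (A ⊕ B) ≡ card A ⊔ card B →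
                isMono (A ⊕ B) ≡ isMono A ∧ isMono B
weak-sum-mono A B A≢[] B≢[] weak rewrite weak = ⊔-is-one (card A) (card B) (card-pos A A≢[]) (card-pos B B≢[])

indicator : Bool → ℕ
indicator true  = 1
indicator false = 0

sumFin : ∀ {N} → (Fin N → ℕ) → ℕ
sumFin {zero}  F = 0
sumFin {suc N} F = F zero + sumFin (F ∘ suc)

count : ∀ {N} → (Fin N → Bool) → ℕ
count s = sumFin (indicator ∘ s)

sumFin-cong : ∀ {N} {F G : Fin N → ℕ} → (∀ i → F i ≡ G i) → sumFin F ≡ sumFin G
sumFin-cong {zero}  F≗G = refl
sumFin-cong {suc N} F≗G = cong₂ _+_ (F≗G zero) (sumFin-cong (F≗G ∘ suc))

count-cong : ∀ {N} {s t : Fin N → Bool} → (∀ i → s i ≡ t i) → count s ≡ count t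
count-cong s≗t = sumFin-cong (cong indicator ∘ s≗t)

count-none : ∀ N → count {N} (λ _ → false) ≡ 0
count-none zero    = refl
count-none (suc N) = count-none N

count-all : ∀ {N} (s : Fin N → Bool) → (∀ i → s i ≡ true) → count s ≡ N
count-all {zero}  s all = refl
count-all {suc N} s all rewrite all zero = cong suc (count-all (s ∘ suc) (all ∘ suc))

length-filter-tabulate : ∀ {A : Set} {N} (p : A → Bool) (g : Fin N → A) →
                         length (filterᵇ p (tabulate g)) ≡ count (p ∘ g)
length-filter-tabulate {N = zero}  p g = refl
length-filter-tabulate {N = suc N} p g with p (g zero)
... | true  = cong suc (length-filter-tabulate p (g ∘ suc))
... | false = length-filter-tabulate p (g ∘ suc)

-- Counting the pairs of a product list that satisfy P, row by row; this turns
-- the list-based count in Defs.monoCount into a double sum over Fin.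
length-filter-pairs : ∀ {A B : Set} {K L} (P : A × B → Bool) (g : Fin K → A) (h : Fin L → B) →
  length (filterᵇ P (cartesianProduct (tabulate g) (tabulate h)))
    ≡ sumFin (λ i → count (λ j → P (g i , h j)))
length-filter-pairs {K = zero}  P g h = refl
length-filter-pairs {K = suc K} P g h = begin
  length (filterᵇ P (row ++ rest))
    ≡⟨ cong length (filter-++ (T? ∘ P) row rest) ⟩
  length (filterᵇ P row ++ filterᵇ P rest)
    ≡⟨ length-++ (filterᵇ P row) ⟩
  length (filterᵇ P row) + length (filterᵇ P rest)
    ≡⟨ cong₂ _+_ first-row (length-filter-pairs P (g ∘ suc) h) ⟩
  count (λ j → P (g zero , h j)) + sumFin (λ i → count (λ j → P (g (suc i) , h j))) ∎
  where
  open ≡-Reasoning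
  row  = map (g zero ,_) (tabulate h)
  rest = cartesianProduct (tabulate (g ∘ suc)) (tabulate h)
  first-row : length (filterᵇ P row) ≡ count (λ j → P (g zero , h j))
  first-row = trans (cong (length ∘ filterᵇ P) (map-tabulate h (g zero ,_)))
                    (length-filter-tabulate P ((g zero ,_) ∘ h))

-- tri k = C(k,2), the number of pairs from a k-element set
tri : ℕ → ℕ
tri zero    = 0
tri (suc k) = k + tri k

tri-mono : ∀ {a b} → a ≤ b → tri a ≤ tri b
tri-mono {b = zero}        z≤n       = z≤n
tri-mono {zero} {suc b}    z≤n       = z≤n
tri-mono {suc a} {suc b}   (s≤s a≤b) = +-mono-≤ a≤b (tri-mono a≤b)

tri-double : ∀ k → tri k * 2 ≡ k * (k ∸ 1)
tri-double zero          = refl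
tri-double (suc zero)    = refl
tri-double (suc (suc j)) = begin
  (suc j + tri (suc j)) * 2       ≡⟨ *-distribʳ-+ 2 (suc j) (tri (suc j)) ⟩
  suc j * 2 + tri (suc j) * 2     ≡⟨ cong (suc j * 2 +_) (tri-double (suc j)) ⟩
  suc j * 2 + suc j * j           ≡⟨ sym (*-distribˡ-+ (suc j) 2 j) ⟩
  suc j * (2 + j)                 ≡⟨ *-comm (suc j) (suc (suc j)) ⟩
  suc (suc j) * suc j             ∎
  where open ≡-Reasoning

tri-closed-form : ∀ k → tri k ≡ (k * (k ∸ 1)) / 2
tri-closed-form k = sym (trans (cong (_/ 2) (sym (tri-double k))) (m*n/n≡m (tri k) 2))

count-pairs-within : ∀ {N} (s : Fin N → Bool) →
  sumFin (λ u → count (λ v → (toℕ u <ᵇ toℕ v) ∧ (s u ∧ s v))) ≡ tri (count s)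
count-pairs-within {zero}  s = refl
count-pairs-within {suc N} s with s zero
... | true  = cong (count (s ∘ suc) +_) (count-pairs-within (s ∘ suc))
... | false = cong₂ _+_ (count-none N) (count-pairs-within (s ∘ suc))

count-cover : ∀ {N} (s : Fin N → Bool) → (∀ u v → toℕ u < toℕ v → s u ≡ true ⊎ s v ≡ true) →
              N ∸ 1 ≤ count s
count-cover {zero}  s cover = z≤n
count-cover {suc N} s cover with s zero in s0
... | true  = ≤-trans (m≤n+m∸n N 1) (s≤s (count-cover (s ∘ suc) (λ u v u<v → cover (suc u) (suc v) (s≤s u<v))))
... | false = ≤-reflexive (sym (count-all (s ∘ suc) (λ v → rest-true (cover zero (suc v) (s≤s z≤n)))))
  where
  rest-true : ∀ {v} → s zero ≡ true ⊎ s (suc v) ≡ true → s (suc v) ≡ true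
  rest-true (inj₁ s0≡true) with () ← trans (sym s0) s0≡true
  rest-true (inj₂ sv)      = sv

edge-ordered : ∀ {N} (G : Graph N) u v → IsEdge G u v → toℕ u < toℕ v
edge-ordered G u v e with toℕ u <ᵇ toℕ v in u<v
... | true = <ᵇ⇒< _ _ (from T-≡ u<v)

IsComplete : ∀ {N} → Graph N → Set
IsComplete G = ∀ u v → isEdge G u v ≡ (toℕ u <ᵇ toℕ v)

monoCount-as-sum : ∀ {N} (G : Graph N) (f : Fin N → FinSet) →
  monoCount G f ≡ sumFin (λ u → count (λ v → isEdge G u v ∧ isMono (f u ⊕ f v)))
monoCount-as-sum {N} G f = length-filter-pairs {K = N} {L = N} _ id id

module _ {N} {G : Graph N} (complete : IsComplete G) {f : Fin N → FinSet} (W : WeakIASI G f) where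
  open WeakIASI W
  open IASI iasi

  mono-edge : ∀ u v → isEdge G u v ∧ isMono (f u ⊕ f v) ≡ (toℕ u <ᵇ toℕ v) ∧ (isMono (f u) ∧ isMono (f v))
  mono-edge u v rewrite complete u v with toℕ u <ᵇ toℕ v in u<v
  ... | false = refl
  ... | true  = weak-sum-mono (f u) (f v) (nonempty u) (nonempty v) (weak u v (trans (complete u v) u<v))

  monoCount-complete : monoCount G f ≡ tri (count (isMono ∘ f))
  monoCount-complete = trans (monoCount-as-sum G f)
    (trans (sumFin-cong (λ u → count-cong (mono-edge u)))
           (count-pairs-within (isMono ∘ f)))

  mono-vertices : N ∸ 1 ≤ count (isMono ∘ f)
  mono-vertices = count-cover (isMono ∘ f) λ u v u<v →
    weak-sum-has-mono-summand (f u) (f v) (nonempty u) (nonempty v)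
      (weak u v (trans (complete u v) (to T-≡ (<⇒<ᵇ u<v))))

pow2-injective : ∀ i j → 2 ^ i ≡ 2 ^ j → i ≡ j
pow2-injective i j eq with <-cmp i j
... | tri< i<j _ _ = ⊥-elim (<-irrefl eq (^-monoʳ-< 2 (s≤s (s≤s z≤n)) i<j))
... | tri≈ _ i≡j _ = i≡j
... | tri> _ _ j<i = ⊥-elim (<-irrefl (sym eq) (^-monoʳ-< 2 (s≤s (s≤s z≤n)) j<i))

-- for i < j < j′ the sum 2^i + 2^j is below 2^(j+1) ≤ 2^j′
pow2-sum-below : ∀ i j i′ j′ → i < j → j < j′ → 2 ^ i + 2 ^ j < 2 ^ i′ + 2 ^ j′
pow2-sum-below i j i′ j′ i<j j<j′ = begin-strict
  2 ^ i + 2 ^ j      <⟨ +-monoˡ-< (2 ^ j) (^-monoʳ-< 2 (s≤s (s≤s z≤n)) i<j) ⟩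
  2 ^ j + 2 ^ j      ≡⟨ cong (2 ^ j +_) (sym (+-identityʳ (2 ^ j))) ⟩
  2 ^ suc j          ≤⟨ ^-monoʳ-≤ 2 j<j′ ⟩
  2 ^ j′             ≤⟨ m≤n+m (2 ^ j′) (2 ^ i′) ⟩
  2 ^ i′ + 2 ^ j′    ∎
  where open ≤-Reasoning

pow2-sidon : ∀ i j i′ j′ → i < j → i′ < j′ → 2 ^ i + 2 ^ j ≡ 2 ^ i′ + 2 ^ j′ → i ≡ i′ × j ≡ j′
pow2-sidon i j i′ j′ i<j i′<j′ eq with <-cmp j j′
... | tri< j<j′ _ _ = ⊥-elim (<-irrefl eq (pow2-sum-below i j i′ j′ i<j j<j′))
... | tri> _ _ j′<j = ⊥-elim (<-irrefl (sym eq) (pow2-sum-below i′ j′ i j i′<j′ j′<j))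
... | tri≈ _ refl _ = pow2-injective i i′ (+-cancelʳ-≡ (2 ^ j) _ _ eq) , refl

powerLabel : ∀ {M} → Fin (suc M) → FinSet
powerLabel zero    = 0 ∷ 1 ∷ []
powerLabel (suc i) = 2 ^ toℕ i ∷ []

card-consecutive : ∀ a → card (a ∷ suc a ∷ []) ≡ 2
card-consecutive a rewrite dec-false (a ≟ suc a) (<⇒≢ (n<1+n a)) = refl

consecutive-in-singleton : ∀ {a c : ℕ} → a ∈ c ∷ [] → suc a ∈ c ∷ [] → ⊥
consecutive-in-singleton (here refl) (here a+1≡a) = <-irrefl (sym a+1≡a) (n<1+n _)

consecutive-in-consecutive : ∀ {a b : ℕ} → a ∈ b ∷ suc b ∷ [] → suc a ∈ b ∷ suc b ∷ [] → a ≡ b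
consecutive-in-consecutive (here a≡b) _ = a≡b
consecutive-in-consecutive (there (here refl)) (here b+2≡b) = ⊥-elim (<-irrefl (sym b+2≡b) (m<n+m _ (s≤s z≤n)))
consecutive-in-consecutive (there (here refl)) (there (here b+2≡b+1)) = ⊥-elim (<-irrefl (sym (suc-injective b+2≡b+1)) (n<1+n _))

powerLabel-injective : ∀ {M} (u v : Fin (suc M)) → powerLabel u ≐ powerLabel v → u ≡ v
powerLabel-injective zero    zero    _ = refl
powerLabel-injective zero    (suc j) eq with to (eq 0) (here refl)
... | here 0≡pow = ⊥-elim (<-irrefl 0≡pow (m^n>0 2 (toℕ j)))
powerLabel-injective (suc i) zero    eq with from (eq 0) (here refl)
... | here 0≡pow = ⊥-elim (<-irrefl 0≡pow (m^n>0 2 (toℕ i)))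
powerLabel-injective (suc i) (suc j) eq with to (eq _) (here refl)
... | here pow≡pow = cong suc (toℕ-injective (pow2-injective _ _ pow≡pow))

-- Labels of ordered pairs: {2^j, 2^j+1} for (0, j+1) and {2^i + 2^j} for (i+1, j+1).
powerLabel-edge-injective : ∀ {M} (u v u′ v′ : Fin (suc M)) → toℕ u < toℕ v → toℕ u′ < toℕ v′ →
  (powerLabel u ⊕ powerLabel v) ≐ (powerLabel u′ ⊕ powerLabel v′) → u ≡ u′ × v ≡ v′
powerLabel-edge-injective zero (suc j) zero (suc j′) _ _ eq =
  refl , cong suc (toℕ-injective (pow2-injective _ _
    (consecutive-in-consecutive (to (eq _) (here refl)) (to (eq _) (there (here refl))))))
powerLabel-edge-injective zero (suc j) (suc i′) (suc j′) _ _ eq =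
  ⊥-elim (consecutive-in-singleton (to (eq _) (here refl)) (to (eq _) (there (here refl))))
powerLabel-edge-injective (suc i) (suc j) zero (suc j′) _ _ eq =
  ⊥-elim (consecutive-in-singleton (from (eq _) (here refl)) (from (eq _) (there (here refl))))
powerLabel-edge-injective (suc i) (suc j) (suc i′) (suc j′) (s≤s i<j) (s≤s i′<j′) eq
  with to (eq _) (here refl)
... | here sum≡sum with pow2-sidon _ _ _ _ i<j i′<j′ sum≡sum
...   | i≡i′ , j≡j′ = cong suc (toℕ-injective i≡i′) , cong suc (toℕ-injective j≡j′)

-- Every pair satisfies the weak condition: |{2^j,2^j+1}| = 2 = max(2,1).
powerLabel-weak-pair : ∀ {M} (u v : Fin (suc M)) → toℕ u < toℕ v →
  card (powerLabel u ⊕ powerLabel v) ≡ card (powerLabel u) ⊔ card (powerLabel v)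
powerLabel-weak-pair zero    (suc j) _ = card-consecutive (2 ^ toℕ j)
powerLabel-weak-pair (suc i) (suc j) _ = refl

powerLabel-weak : ∀ {M} (G : Graph (suc M)) → WeakIASI G powerLabel
powerLabel-weak G = record
  { iasi = record
    { nonempty  = λ { zero () ; (suc _) () }
    ; injective = powerLabel-injective
    ; edgeInj   = λ u v u′ v′ e e′ → powerLabel-edge-injective u v u′ v′
                    (edge-ordered G u v e) (edge-ordered G u′ v′ e′)
    }
  ; weak = λ u v e → powerLabel-weak-pair u v (edge-ordered G u v e)
  }

count-mono-powerLabel : ∀ M → count (isMono ∘ powerLabel {M}) ≡ M
count-mono-powerLabel M = count-all (isMono ∘ powerLabel ∘ suc) (λ _ → refl)

-- φ(K_{M+1}) = C(M,2): the power labelling attains C(M,2), and every weak IASI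
-- has at least M mono-indexed vertices, hence at least C(M,2) mono-indexed edges.
sparing-complete : ∀ {M} (G : Graph (suc M)) → IsComplete G → SparingNumber G (tri M)
sparing-complete {M} G complete =
  (powerLabel , powerLabel-weak G ,
    trans (monoCount-complete complete (powerLabel-weak G)) (cong tri (count-mono-powerLabel M))) ,
  λ f W → ≤-trans (tri-mono (mono-vertices complete W))
                   (≤-reflexive (sym (monoCount-complete complete W)))

adjacent⇒complete : ∀ {N} (G : Graph N) → (∀ (u v : Fin N) → toℕ u < toℕ v → G u v ≡ true) → IsComplete G
adjacent⇒complete G adj u v with toℕ u <ᵇ toℕ v in u<v
... | false = refl
... | true  = adj u v (<ᵇ⇒< _ _ (from T-≡ u<v))

<⇒==-false : ∀ {N} (u v : Fin N) → toℕ u < toℕ v → (u == v) ≡ false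
<⇒==-false u v u<v = dec-false (toℕ u ≟ toℕ v) (<⇒≢ u<v)

square-edge : ∀ {N} (G : Graph N) u v → toℕ u < toℕ v → G u v ≡ true → square G u v ≡ true
square-edge G u v u<v e rewrite <⇒==-false u v u<v | e = refl

any-intro : ∀ {A : Set} (p : A → Bool) {xs x} → x ∈ xs → p x ≡ true → any p xs ≡ true
any-intro p {y ∷ _} (here refl) px rewrite px = refl
any-intro p {y ∷ _} (there x∈) px = trans (cong (p y ∨_) (any-intro p x∈ px)) (∨-zeroʳ (p y))

square-path : ∀ {N} (G : Graph N) u v w → toℕ u < toℕ v → (G u w ∧ G w v) ≡ true → square G u v ≡ true
square-path {N} G u v w u<v path rewrite <⇒==-false u v u<v =
  trans (cong (G u v ∨_) (any-intro (λ w → G u w ∧ G w v) (∈-allFin w) path)) (∨-zeroʳ (G u v))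

xor-≢ : ∀ a b → a ≢ b → a xor b ≡ true
xor-≢ false false a≢b = ⊥-elim (a≢b refl)
xor-≢ false true  _   = refl
xor-≢ true  false _   = refl
xor-≢ true  true  a≢b = ⊥-elim (a≢b refl)

module _ (m′ n′ : ℕ) where
  private
    m = suc m′
    N = m + suc n′

  side : Fin N → Bool
  side w = toℕ w <ᵇ m

  vertex-on-side : ∀ b → ∃ λ (w : Fin N) → side w ≡ b
  vertex-on-side true  = zero , refl
  vertex-on-side false = w , subst (λ x → (x <ᵇ m) ≡ false) (sym (toℕ-fromℕ< m<N)) (<ᵇ-irrefl m)
    where
    m<N = m<m+n m {suc n′} (s≤s z≤n)
    w = fromℕ< m<N
    <ᵇ-irrefl : ∀ k → (k <ᵇ k) ≡ false
    <ᵇ-irrefl zero    = refl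
    <ᵇ-irrefl (suc k) = <ᵇ-irrefl k

  -- Two vertices in the same part are joined through any vertex of the other part.
  square-K-adjacent : ∀ (u v : Fin N) → toℕ u < toℕ v → square (K m (suc n′)) u v ≡ true
  square-K-adjacent u v u<v with side u Bool.≟ side v
  ... | no  sides≢ = square-edge (K m (suc n′)) u v u<v (xor-≢ (side u) (side v) sides≢)
  ... | yes sides≡ with vertex-on-side (not (side u))
  ...   | w , w-opposite = square-path (K m (suc n′)) u v w u<v path
    where
    path : ((side u xor side w) ∧ (side w xor side v)) ≡ true
    path rewrite w-opposite | sym sides≡ = cong₂ _∧_ (xor-inverseʳ (side u)) (xor-inverseˡ (side u))

  square-K-complete : IsComplete (square (K m (suc n′)))
  square-K-complete = adjacent⇒complete _ square-K-adjacent

theorem2p3 : ∀ (m n : ℕ) → 1 ≤ m → 1 ≤ n →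
    SparingNumber (square (K m n)) (((m + n ∸ 1) * (m + n ∸ 2)) / 2)
theorem2p3 (suc m′) (suc n′) _ _ =
  subst (SparingNumber G) (tri-closed-form (m′ + suc n′))
        (sparing-complete G (square-K-complete m′ n′))
  where
  G = square (K (suc m′) (suc n′))
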